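{- Let $G$ be a $g$-tiling graph such that (i) $g\geq 7$ is odd; (ii) $\partial G$ is an even cycle; (iii) there is an automorphism $x\mapsto -x$ of $G$ mapping every vertex of $\partial G$ to its antipode in the cycle $\partial G$; (iv) $\mathrm{dist}_G(x,-x)\geq g$ for every vertex $x$ of $\partial G$; (v) there is an odd integer $h\geq (g+1)/2$ and a set $U=\{u_0,\dots,u_{2h-1}\}$ of border vertices of degree $2$ such that $u_{i+h}=-u_i$ for $0\leq i\leq h-1$ and $\mathrm{dist}_G(u_i,u_j)\geq g$ for $0\leq i<j\leq 2h-1$. Let $\overline T$ be the graph $G\cup\{\{x,-x\}\mid \deg_G(x)=2\}\cup\{\{u_{2i},u_{2i+1}\}\mid 0\leq i\leq h-1\}$. Then every shortest odd cycle of $\overline T$ is contained in $G$.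
   Context: For an integer $g\geq 7$, a $g$-tiling graph is a (finite, simple) plane graph $G$ such that: every bounded face has exactly $g$ vertices; every edge belongs to two faces; every vertex of the unbounded face has degree $2$ or $3$; all remaining vertices have degree $3$. $\partial G$ denotes the subgraph formed by the vertices and edges of the unbounded face; its vertices are the border vertices, the others are interior vertices. $\mathrm{dist}_G$ is graph distance in $G$. -}

module Defs where

open import Data.Nat using (ℕ; zero; suc; _+_; _*_; _≤_; _<_)
open import Data.Fin using (Fin; _≟_)
open import Data.List using (length; filter; allFin)
open import Data.Product using (Σ; ∃; _×_; _,_)
open import Data.Sum using (_⊎_)
open import Relation.Nullary using (¬_)
open import Relation.Binary.PropositionalEquality using (_≡_; _≢_)
open import Function.Bundles using (_⇔_)

iter : {A : Set} → (A → A) → ℕ → A → A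
iter f zero    x = x
iter f (suc k) x = f (iter f k x)

Odd : ℕ → Set
Odd m = ∃ λ k → m ≡ suc (2 * k)

data Walk {A : Set} (R : A → A → Set) : A → A → ℕ → Set where
  here : ∀ {u} → Walk R u u zero
  step : ∀ {u v w k} → R u v → Walk R v w k → Walk R u w (suc k)

-- dist_R(u,v) ≥ k  (no walk of length < k; includes dist = ∞)
DistGe : {A : Set} → (A → A → Set) → A → A → ℕ → Set
DistGe R u v k = ∀ m → m < k → ¬ Walk R u v m

HasCard : {n : ℕ} → (Fin n → Set) → ℕ → Set
HasCard {n} P c = Σ (Fin c → Fin n) λ f →
  (∀ i j → f i ≡ f j → i ≡ j) × (∀ v → P v ⇔ (∃ λ i → f i ≡ v))

IsCycle : {A : Set} → (A → A → Set) → ℕ → (ℕ → A) → Set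
IsCycle R k c =
  (3 ≤ k) ×
  (∀ i j → i < k → j < k → c i ≡ c j → i ≡ j) ×
  (∀ i → i < k → R (c i) (c (suc i))) ×
  (c k ≡ c 0)

-- A connected plane graph with a distinguished unbounded face, encoded as a
-- combinatorial map (rotation system) of genus 0.
-- Vertices: Fin nV.  Darts (oriented edges): Fin nD.
-- rev: reverse dart; σ: rotation around the tail vertex; faces = orbits of φ = σ ∘ rev.
record PlaneGraph : Set where
  field
    nV nD nF : ℕ
    tl   : Fin nD → Fin nV
    rev  : Fin nD → Fin nD
    σ    : Fin nD → Fin nD
    σ⁻   : Fin nD → Fin nD
    rev-invol : ∀ x → rev (rev x) ≡ x
    rev-nofix : ∀ x → rev x ≢ x
    σσ⁻  : ∀ x → σ (σ⁻ x) ≡ x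
    σ⁻σ  : ∀ x → σ⁻ (σ x) ≡ x
    σ-tl : ∀ x → tl (σ x) ≡ tl x
    σ-transitive : ∀ x y → tl x ≡ tl y → ∃ λ k → iter σ k x ≡ y
  hd : Fin nD → Fin nV
  hd x = tl (rev x)
  φ : Fin nD → Fin nD
  φ x = σ (rev x)
  Adj : Fin nV → Fin nV → Set
  Adj u v = ∃ λ x → tl x ≡ u × hd x ≡ v
  field
    no-loop  : ∀ x → tl x ≢ hd x
    no-multi : ∀ x y → tl x ≡ tl y → hd x ≡ hd y → x ≡ y
    connected : ∀ u v → ∃ λ k → Walk Adj u v k
    face      : Fin nD → Fin nF
    face-surj : ∀ f → ∃ λ x → face x ≡ f
    face-spec : ∀ x y → (face x ≡ face y) ⇔ (∃ λ k → iter φ k x ≡ y)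
    -- genus 0 (Euler's formula V - E + F = 2, with E = nD / 2)
    euler : 2 * nV + 2 * nF ≡ nD + 4
    outer : Fin nD
  deg : Fin nV → ℕ
  deg v = length (filter (λ x → tl x ≟ v) (allFin nD))
  FaceVertex : Fin nD → Fin nV → Set
  FaceVertex x v = ∃ λ k → tl (iter φ k x) ≡ v
  Border : Fin nV → Set
  Border = FaceVertex outer
  Bounded : Fin nD → Set
  Bounded x = face x ≢ face outer

record IsTiling (g : ℕ) (G : PlaneGraph) : Set where
  open PlaneGraph G
  field
    bounded-faces : ∀ x → Bounded x → HasCard (FaceVertex x) g
    two-faces     : ∀ x → face x ≢ face (rev x)
    deg-border    : ∀ v → Border v → deg v ≡ 2 ⊎ deg v ≡ 3
    deg-interior  : ∀ v → ¬ Border v → deg v ≡ 3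

BoundaryEvenCycle : PlaneGraph → ℕ → Set
BoundaryEvenCycle G L =
  (2 ≤ L) ×
  (iter φ (2 * L) outer ≡ outer) ×
  (∀ i j → i < 2 * L → j < 2 * L → tl (iter φ i outer) ≡ tl (iter φ j outer) → i ≡ j)
  where open PlaneGraph G

IsAutomorphism : (G : PlaneGraph) → (Fin (PlaneGraph.nV G) → Fin (PlaneGraph.nV G)) → Set
IsAutomorphism G α =
  (Σ (Fin nV → Fin nV) λ β → (∀ v → α (β v) ≡ v) × (∀ v → β (α v) ≡ v)) ×
  (∀ u v → Adj u v ⇔ Adj (α u) (α v))
  where open PlaneGraph G

TAdj : (G : PlaneGraph) → (α : Fin (PlaneGraph.nV G) → Fin (PlaneGraph.nV G)) →
       (h : ℕ) → (u : ℕ → Fin (PlaneGraph.nV G)) →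
       Fin (PlaneGraph.nV G) → Fin (PlaneGraph.nV G) → Set
TAdj G α h u x y =
  Adj x y ⊎
  ((deg x ≡ 2 × y ≡ α x) ⊎ (deg y ≡ 2 × x ≡ α y)) ⊎
  (∃ λ i → i < h ×
     ((x ≡ u (2 * i) × y ≡ u (suc (2 * i))) ⊎ (y ≡ u (2 * i) × x ≡ u (suc (2 * i)))))
  where open PlaneGraph G

{-# OPTIONS --safe #-}
-- The boundary walk of a bounded face is a closed walk of odd length g in G, and an odd closed
-- walk contains an odd cycle at most as long, so the shortest odd cycle length k of T̄ is at most g
-- and every odd closed walk in G has length at least k.  Suppose a shortest odd cycle uses an edge
-- outside G, and go around it starting with that edge, carrying a walk in G, strictly shorter than
-- the distance travelled, from a reference vertex to the current vertex: G-edges extend the walk,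
-- and an antipodal edge {x, -x} is absorbed by applying the automorphism to it.  If the cycle has
-- an edge {u_2i, u_2i+1}, the reference vertex is some u_q; whenever such an edge is reached, the
-- walk ends at u_q itself (it is shorter than g) and has even length (it is shorter than k), and
-- it restarts at the partner.
-- Since h is odd, both -u_q = u_(q±h) and the partner flip the parity of q, so the parity of
-- (distance + walk length + q) is invariant, and back at the start it forces k to be even.
-- Otherwise the reference vertex is x or -x for the first vertex x of an antipodal edge, and back
-- at x we get an odd closed walk shorter than k or a walk from -x to x shorter than g.
module Submission where

open import Defs
open import Data.Bool using (Bool; true; false; not; _xor_; if_then_else_)
open import Data.Bool.Properties
  using (not-involutive; not-injective; not-distribˡ-xor; not-distribʳ-xor; xor-same; xor-comm; true-xor; xor-inverseˡ; xor-identityʳ)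
open import Data.Empty using (⊥; ⊥-elim)
open import Data.Fin using (Fin; toℕ; fromℕ<; _≟_)
import Data.Fin.Properties as Finₚ
open import Data.List using (filter; allFin; lookup)
open import Data.List.Membership.Propositional.Properties using (∈-filter⁺; ∈-allFin)
import Data.List.Relation.Unary.Any as Any
open import Data.List.Relation.Unary.Any.Properties using (lookup-index)
open import Data.Nat using (ℕ; zero; suc; _+_; _*_; _∸_; _≤_; _<_; z≤n; s≤s; z<s; _<?_; NonZero; >-nonZero; _%_; _/_)
open import Data.Nat.DivMod
open import Data.Nat.Induction using (<-rec)
open import Data.Nat.Properties hiding (_≟_)
open import Data.Product using (∃; ∃₂; _×_; _,_; proj₁; proj₂)
open import Data.Sum using (_⊎_; inj₁; inj₂; [_,_]′)
open import Function.Bundles using (Equivalence)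
open import Function.Base using (id)
open import Function.Definitions using (Injective)
open import Relation.Binary.Definitions using (DecidableEquality; tri<; tri≈; tri>)
open import Relation.Binary.PropositionalEquality
open import Relation.Nullary using (¬_; Dec; yes; no; contradiction)
open import Relation.Nullary.Decidable using (map′; decidable-stable)

parity : ℕ → Bool
parity zero    = false
parity (suc n) = not (parity n)

parity-+ : ∀ m n → parity (m + n) ≡ parity m xor parity n
parity-+ zero    n = refl
parity-+ (suc m) n = trans (cong not (parity-+ m n)) (not-distribˡ-xor (parity m) (parity n))

parity-double : ∀ n → parity (2 * n) ≡ false
parity-double n = begin
  parity (n + (n + 0))         ≡⟨ parity-+ n (n + 0) ⟩
  parity n xor parity (n + 0)  ≡⟨ cong (λ m → parity n xor parity m) (+-identityʳ n) ⟩
  parity n xor parity n        ≡⟨ xor-same (parity n) ⟩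
  false                        ∎
  where open ≡-Reasoning

Odd⇒parity≡true : ∀ {n} → Odd n → parity n ≡ true
Odd⇒parity≡true (m , refl) = cong not (parity-double m)

parity≡true⇒Odd : ∀ {n} → parity n ≡ true → Odd n
parity≡false⇒even : ∀ {n} → parity n ≡ false → ∃ λ m → n ≡ 2 * m

parity≡true⇒Odd {suc n} p with m , refl ← parity≡false⇒even {n} (not-injective p) = m , refl
parity≡false⇒even {zero}  _ = 0 , refl
parity≡false⇒even {suc n} p with m , refl ← parity≡true⇒Odd {n} (not-injective p) =
  suc m , cong suc (sym (+-suc m (m + 0)))

Odd-+ : ∀ m n → Odd (m + n) → Odd m ⊎ Odd n
Odd-+ m n odd with parity m in pm
... | true  = inj₁ (parity≡true⇒Odd pm)
... | false = inj₂ (parity≡true⇒Odd (begin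
  parity n                ≡⟨ cong (_xor parity n) pm ⟨
  parity m xor parity n   ≡⟨ parity-+ m n ⟨
  parity (m + n)          ≡⟨ Odd⇒parity≡true odd ⟩
  true                    ∎))
  where open ≡-Reasoning

flip-xor : ∀ {a b} c → b ≡ not a → not (a xor c) ≡ b xor c
flip-xor {a} c b≡¬a = trans (not-distribˡ-xor a c) (cong (_xor c) (sym b≡¬a))

invariant-from-1 : ∀ {P : ℕ → Set} {k} → P 1 → (∀ j → j < k → P j → P (suc j)) → 1 ≤ k → P k
invariant-from-1 {k = suc zero}    start advance _ = start
invariant-from-1 {k = suc (suc k)} start advance _ =
  advance (suc k) ≤-refl (invariant-from-1 start (λ j j<k → advance j (m<n⇒m<1+n j<k)) (s≤s z≤n))

module _ {A : Set} (f : A → A) where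

  iter-+ : ∀ m n x → iter f (m + n) x ≡ iter f m (iter f n x)
  iter-+ zero    n x = refl
  iter-+ (suc m) n x = cong f (iter-+ m n x)

  iter-injective : Injective _≡_ _≡_ f → ∀ n → Injective _≡_ _≡_ (iter f n)
  iter-injective f-inj zero    eq = eq
  iter-injective f-inj (suc n) eq = iter-injective f-inj n (f-inj eq)

  iter-mod : ∀ {p x} .{{_ : NonZero p}} → iter f p x ≡ x → ∀ m → iter f m x ≡ iter f (m % p) x
  iter-mod {p} {x} period m = begin
    iter f m x                                ≡⟨ cong (λ n → iter f n x) (m≡m%n+[m/n]*n m p) ⟩
    iter f (m % p + (m / p) * p) x            ≡⟨ iter-+ (m % p) ((m / p) * p) x ⟩
    iter f (m % p) (iter f ((m / p) * p) x)   ≡⟨ cong (iter f (m % p)) (periods (m / p)) ⟩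
    iter f (m % p) x                          ∎
    where
    open ≡-Reasoning
    periods : ∀ q → iter f (q * p) x ≡ x
    periods zero    = refl
    periods (suc q) = trans (iter-+ p (q * p) x) (trans (cong (iter f p) (periods q)) period)

  iter-returns : Injective _≡_ _≡_ f → ∀ {m} x (class : ℕ → Fin m) →
                 (∀ {i j} → class i ≡ class j → iter f i x ≡ iter f j x) →
                 ∃ λ p → suc p ≤ m × iter f (suc p) x ≡ x
  iter-returns f-inj {m} x class separates
    with i , j , i<j , same ← Finₚ.pigeonhole (n<1+n m) (λ i → class (toℕ i))
    with p , i+1+p≡j ← m≤n⇒∃[o]m+o≡n i<j =
    p , ≤-trans (m≤n+m (suc p) (toℕ i)) (≤-pred (subst (_< suc m) j≡i+1+p (Finₚ.toℕ<n j))) ,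
    iter-injective f-inj (toℕ i) (sym (begin
      iter f (toℕ i) x                      ≡⟨ separates same ⟩
      iter f (toℕ j) x                      ≡⟨ cong (λ n → iter f n x) j≡i+1+p ⟩
      iter f (toℕ i + suc p) x              ≡⟨ iter-+ (toℕ i) (suc p) x ⟩
      iter f (toℕ i) (iter f (suc p) x)     ∎))
    where
    open ≡-Reasoning
    j≡i+1+p : toℕ j ≡ toℕ i + suc p
    j≡i+1+p = trans (sym i+1+p≡j) (sym (+-suc (toℕ i) p))

module _ {A : Set} {R : A → A → Set} where

  infixl 5 _∷ʳ_
  _∷ʳ_ : ∀ {x y z n} → Walk R x y n → R y z → Walk R x z (suc n)
  here       ∷ʳ r = step r here
  step r′ w  ∷ʳ r = step r′ (w ∷ʳ r)

  reverseWalk : (∀ {x y} → R x y → R y x) → ∀ {x y n} → Walk R x y n → Walk R y x n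
  reverseWalk sym-R here       = here
  reverseWalk sym-R (step r w) = reverseWalk sym-R w ∷ʳ sym-R r

  mapWalk : (f : A → A) → (∀ {x y} → R x y → R (f x) (f y)) →
            ∀ {x y n} → Walk R x y n → Walk R (f x) (f y) n
  mapWalk f f-R here       = here
  mapWalk f f-R (step r w) = step (f-R r) (mapWalk f f-R w)

  vertex : ∀ {x y n} → Walk R x y n → ℕ → A
  vertex {x} here       _       = x
  vertex {x} (step r w) zero    = x
  vertex     (step r w) (suc i) = vertex w i

  vertex-first : ∀ {x y n} (w : Walk R x y n) → vertex w 0 ≡ x
  vertex-first here       = refl
  vertex-first (step r w) = refl

  vertex-last : ∀ {x y n} (w : Walk R x y n) → vertex w n ≡ y
  vertex-last here       = refl
  vertex-last (step r w) = vertex-last w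

  vertex-step : ∀ {x y n} (w : Walk R x y n) → ∀ i → i < n → R (vertex w i) (vertex w (suc i))
  vertex-step (step r w) zero    _         = subst (R _) (sym (vertex-first w)) r
  vertex-step (step r w) (suc i) (s≤s i<n) = vertex-step w i i<n

ClosedWalk : {A : Set} → (A → A → Set) → ℕ → (ℕ → A) → Set
ClosedWalk R ℓ f = (∀ i → i < ℓ → R (f i) (f (suc i))) × f ℓ ≡ f 0

closedWalk : ∀ {A R} {x : A} {ℓ} (w : Walk R x x ℓ) → ClosedWalk R ℓ (vertex w)
closedWalk w = vertex-step w , trans (vertex-last w) (sym (vertex-first w))

rotate : {A : Set} (ℓ : ℕ) .{{_ : NonZero ℓ}} → (ℕ → A) → ℕ → ℕ → A
rotate ℓ f i j = f ((i + j) % ℓ)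

module _ {A : Set} {ℓ : ℕ} .{{_ : NonZero ℓ}} {f : ℕ → A} (closes : f ℓ ≡ f 0) where

  wrap : ∀ {r} → r < ℓ → f (suc r % ℓ) ≡ f (suc r)
  wrap {r} r<ℓ with m≤n⇒m<n∨m≡n r<ℓ
  ... | inj₁ r+1<ℓ = cong f (m<n⇒m%n≡m r+1<ℓ)
  ... | inj₂ r+1≡ℓ = trans (cong f (trans (cong (_% ℓ) r+1≡ℓ) (n%n≡0 ℓ)))
                           (trans (sym closes) (cong f (sym r+1≡ℓ)))

  rotate-next : ∀ i j → rotate ℓ f i (suc j) ≡ f (suc ((i + j) % ℓ))
  rotate-next i j = begin
    f ((i + suc j) % ℓ)          ≡⟨ cong (λ n → f (n % ℓ)) (+-suc i j) ⟩
    f (suc n % ℓ)                ≡⟨ cong (λ m → f (suc m % ℓ)) (m≡m%n+[m/n]*n n ℓ) ⟩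
    f ((suc (n % ℓ) + (n / ℓ) * ℓ) % ℓ) ≡⟨ cong f ([m+kn]%n≡m%n (suc (n % ℓ)) (n / ℓ) ℓ) ⟩
    f (suc (n % ℓ) % ℓ)          ≡⟨ wrap (m%n<n n ℓ) ⟩
    f (suc (n % ℓ))              ∎
    where
    open ≡-Reasoning
    n = i + j

  rotate-steps : ∀ {S : A → A → Set} → (∀ r → r < ℓ → S (f r) (f (suc r))) →
                 ∀ i j → S (rotate ℓ f i j) (rotate ℓ f i (suc j))
  rotate-steps {S} steps i j = subst (S _) (sym (rotate-next i j)) (steps _ (m%n<n (i + j) ℓ))

  rotate-start : ∀ {i} → i < ℓ → rotate ℓ f i 0 ≡ f i × rotate ℓ f i 1 ≡ f (suc i)
  rotate-start {i} i<ℓ = cong f i%ℓ≡i , trans (rotate-next i 0) (cong (λ n → f (suc n)) i%ℓ≡i)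
    where
    i%ℓ≡i : (i + 0) % ℓ ≡ i
    i%ℓ≡i = trans (cong (_% ℓ) (+-identityʳ i)) (m<n⇒m%n≡m i<ℓ)

module _ {A : Set} {R : A → A → Set} where

  rotate-closedWalk : ∀ {ℓ f} .{{_ : NonZero ℓ}} → ClosedWalk R ℓ f → ∀ i → ClosedWalk R ℓ (rotate ℓ f i)
  rotate-closedWalk {ℓ} {f} (steps , closes) i =
    (λ j _ → rotate-steps {f = f} closes {S = R} steps i j) ,
    cong f (trans ([m+n]%n≡m%n i ℓ) (cong (_% ℓ) (sym (+-identityʳ i))))

  closedWalk-split : ∀ {ℓ f D} → ClosedWalk R ℓ f → D ≤ ℓ → f D ≡ f 0 →
                     ClosedWalk R D f × ClosedWalk R (ℓ ∸ D) (λ m → f (D + m))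
  closedWalk-split {ℓ} {f} {D} (steps , closes) D≤ℓ loop =
    ((λ i i<D → steps i (<-≤-trans i<D D≤ℓ)) , loop) ,
    (λ i i<ℓ-D → subst (λ n → R (f (D + i)) (f n)) (sym (+-suc D i))
                   (steps (D + i) (subst (D + i <_) (m+[n∸m]≡n D≤ℓ) (+-monoʳ-< D i<ℓ-D)))) ,
    trans (cong f (m+[n∸m]≡n D≤ℓ)) (trans closes (trans (sym loop) (cong f (sym (+-identityʳ D)))))

  closedWalk-decompose : ∀ {ℓ f i j} → ClosedWalk R ℓ f → i < j → j < ℓ → f i ≡ f j →
    ∃₂ λ D g → 0 < D × D < ℓ × ClosedWalk R D g × ClosedWalk R (ℓ ∸ D) (λ m → g (D + m))
  closedWalk-decompose {ℓ} {f} {i} {j} walk i<j j<ℓ fi≡fj =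
    j ∸ i , rotate ℓ f i , m<n⇒0<n∸m i<j , ≤-<-trans (m∸n≤m j i) j<ℓ ,
    closedWalk-split (rotate-closedWalk walk i) (≤-trans (m∸n≤m j i) (<⇒≤ j<ℓ)) loop
    where
    instance
      ℓ-nonZero : NonZero ℓ
      ℓ-nonZero = >-nonZero (<-≤-trans z<s j<ℓ)
    loop : rotate ℓ f i (j ∸ i) ≡ rotate ℓ f i 0
    loop = begin
      f ((i + (j ∸ i)) % ℓ)  ≡⟨ cong (λ n → f (n % ℓ)) (m+[n∸m]≡n (<⇒≤ i<j)) ⟩
      f (j % ℓ)              ≡⟨ cong f (m<n⇒m%n≡m j<ℓ) ⟩
      f j                    ≡⟨ fi≡fj ⟨
      f i                    ≡⟨ proj₁ (rotate-start (proj₂ walk) (<-trans i<j j<ℓ)) ⟨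
      rotate ℓ f i 0         ∎
      where open ≡-Reasoning

module _ {A : Set} (_≟_ : DecidableEquality A) (R : A → A → Set) (R-irrefl : ∀ {x} → ¬ R x x) where

  OddCycleWithin : ℕ → Set
  OddCycleWithin ℓ = ∃₂ λ k c → IsCycle R k c × Odd k × k ≤ ℓ

  oddClosedWalk-length≥3 : ∀ {ℓ f} → ClosedWalk R ℓ f → Odd ℓ → 3 ≤ ℓ
  oddClosedWalk-length≥3 (steps , closes) (zero , refl) = ⊥-elim (R-irrefl (subst (R _) closes (steps 0 z<s)))
  oddClosedWalk-length≥3 _ (suc m , refl) = s≤s (s≤s (≤-trans (s≤s z≤n) (m≤n+m _ m)))

  oddClosedWalk⇒oddCycle : ∀ ℓ {f} → ClosedWalk R ℓ f → Odd ℓ → OddCycleWithin ℓ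
  oddClosedWalk⇒oddCycle = <-rec (λ ℓ → ∀ {f} → ClosedWalk R ℓ f → Odd ℓ → OddCycleWithin ℓ) extract
    where
    weaken : ∀ {ℓ′ ℓ} → ℓ′ ≤ ℓ → OddCycleWithin ℓ′ → OddCycleWithin ℓ
    weaken ℓ′≤ℓ (k , c , cycle , odd , k≤ℓ′) = k , c , cycle , odd , ≤-trans k≤ℓ′ ℓ′≤ℓ

    extract : ∀ ℓ → (∀ {ℓ′} → ℓ′ < ℓ → ∀ {f} → ClosedWalk R ℓ′ f → Odd ℓ′ → OddCycleWithin ℓ′) →
              ∀ {f} → ClosedWalk R ℓ f → Odd ℓ → OddCycleWithin ℓ
    extract ℓ recurse {f} walk odd with anyUpTo? (λ j → anyUpTo? (λ i → f i ≟ f j) j) ℓ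
    ... | no simple = ℓ , f , (oddClosedWalk-length≥3 walk odd , injective , walk) , odd , ≤-refl
      where
      injective : ∀ i j → i < ℓ → j < ℓ → f i ≡ f j → i ≡ j
      injective i j i<ℓ j<ℓ fi≡fj with <-cmp i j
      ... | tri< i<j _ _ = ⊥-elim (simple (j , j<ℓ , i , i<j , fi≡fj))
      ... | tri≈ _ i≡j _ = i≡j
      ... | tri> _ _ j<i = ⊥-elim (simple (i , i<ℓ , j , j<i , sym fi≡fj))
    ... | yes (j , j<ℓ , i , i<j , fi≡fj)
      with D , g , 0<D , D<ℓ , inner , outer ← closedWalk-decompose {R = R} {f = f} walk i<j j<ℓ fi≡fj
      with Odd-+ D (ℓ ∸ D) (subst Odd (sym (m+[n∸m]≡n (<⇒≤ D<ℓ))) odd)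
    ... | inj₁ odd-D    = weaken (<⇒≤ D<ℓ) (recurse D<ℓ inner odd-D)
    ... | inj₂ odd-rest = weaken (m∸n≤m ℓ D) (recurse (∸-monoʳ-< 0<D (<⇒≤ D<ℓ)) outer odd-rest)

module PlaneGraphProperties (G : PlaneGraph) where
  open PlaneGraph G

  Adj-sym : ∀ {v w} → Adj v w → Adj w v
  Adj-sym (x , tl-x , hd-x) = rev x , hd-x , trans (cong tl (rev-invol x)) tl-x

  Adj-irrefl : ∀ {v} → ¬ Adj v v
  Adj-irrefl (x , tl-x , hd-x) = no-loop x (trans tl-x (sym hd-x))

  σ-injective : Injective _≡_ _≡_ σ
  σ-injective {x} {y} eq = trans (sym (σ⁻σ x)) (trans (cong σ⁻ eq) (σ⁻σ y))

  φ-injective : Injective _≡_ _≡_ φ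
  φ-injective {x} {y} eq = trans (sym (rev-invol x)) (trans (cong rev (σ-injective eq)) (rev-invol y))

  tl-iter-σ : ∀ n x → tl (iter σ n x) ≡ tl x
  tl-iter-σ zero    x = refl
  tl-iter-σ (suc n) x = trans (σ-tl _) (tl-iter-σ n x)

  face-iter-φ : ∀ n x → face (iter φ n x) ≡ face x
  face-iter-φ n x = sym (Equivalence.from (face-spec x (iter φ n x)) (n , refl))

  face-σ : ∀ x → face (σ x) ≡ face (rev x)
  face-σ x = trans (cong (λ y → face (σ y)) (sym (rev-invol x))) (face-iter-φ 1 (rev x))

  faceWalk : ∀ x n → Walk Adj (tl x) (tl (iter φ n x)) n
  faceWalk x zero    = here
  faceWalk x (suc n) = faceWalk x n ∷ʳ (iter φ n x , refl , sym (σ-tl _))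

  FaceVertex? : ∀ x v → Dec (FaceVertex x v)
  FaceVertex? x v with p , _ , period ← iter-returns φ φ-injective x (λ n → iter φ n x) id =
    map′ (λ (n , _ , tl≡v) → n , tl≡v)
         (λ (n , tl≡v) → n % suc p , m%n<n n (suc p) , trans (cong tl (sym (iter-mod φ period n))) tl≡v)
         (anyUpTo? (λ n → tl (iter φ n x) ≟ v) (suc p))

  dartIndex : ∀ {v} x → tl x ≡ v → Fin (deg v)
  dartIndex {v} x tl-x = Any.index (∈-filter⁺ (λ y → tl y ≟ v) (∈-allFin x) tl-x)

  dartIndex-injective : ∀ {v x y} (tl-x : tl x ≡ v) (tl-y : tl y ≡ v) →
                        dartIndex x tl-x ≡ dartIndex y tl-y → x ≡ y
  dartIndex-injective {v} {x} {y} tl-x tl-y eq =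
    trans (lookup-index (∈-filter⁺ _ (∈-allFin x) tl-x))
          (trans (cong (lookup (filter (λ z → tl z ≟ v) (allFin nD))) eq)
                 (sym (lookup-index (∈-filter⁺ _ (∈-allFin y) tl-y))))

  σ-period : ∀ x → ∃ λ p → suc p ≤ deg (tl x) × iter σ (suc p) x ≡ x
  σ-period x = iter-returns σ σ-injective x (λ n → dartIndex (iter σ n x) (tl-iter-σ n x)) (dartIndex-injective _ _)

  faceSize≤period : ∀ {x m p} → HasCard (FaceVertex x) m → iter φ (suc p) x ≡ x → m ≤ suc p
  faceSize≤period {x} {m} {p} (vertexAt , vertexAt-injective , spec) period =
    Finₚ.injective⇒≤ {f = position} position-injective
    where
    time : Fin m → ℕ
    time i = proj₁ (Equivalence.from (spec (vertexAt i)) (i , refl))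
    tl-time : ∀ i → tl (iter φ (time i % suc p) x) ≡ vertexAt i
    tl-time i = trans (cong tl (sym (iter-mod φ period (time i))))
                      (proj₂ (Equivalence.from (spec (vertexAt i)) (i , refl)))
    position : Fin m → Fin (suc p)
    position i = fromℕ< (m%n<n (time i) (suc p))
    position-injective : Injective _≡_ _≡_ position
    position-injective {i} {j} eq = vertexAt-injective i j (begin
      vertexAt i                          ≡⟨ tl-time i ⟨
      tl (iter φ (time i % suc p) x)      ≡⟨ cong (λ n → tl (iter φ n x)) same-time ⟩
      tl (iter φ (time j % suc p) x)      ≡⟨ tl-time j ⟩
      vertexAt j                          ∎)
      where
      open ≡-Reasoning
      same-time : time i % suc p ≡ time j % suc p
      same-time = trans (sym (Finₚ.toℕ-fromℕ< _)) (trans (cong toℕ eq) (Finₚ.toℕ-fromℕ< _))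

  module _ (two-faces : ∀ x → face x ≢ face (rev x)) (deg≤3 : ∀ v → deg v ≤ 3) where

    face-σ≢ : ∀ x → face (σ x) ≢ face x
    face-σ≢ x eq = two-faces x (trans (sym eq) (face-σ x))

    -- Here σ^t x is σ x or σ⁻¹ x, and neither lies on the face of x.
    short-σ-orbit-meets-face-once : ∀ {x} p t → iter σ (suc p) x ≡ x → suc p ≤ 3 → t < suc p →
                                    face (iter σ t x) ≡ face x → iter σ t x ≡ x
    short-σ-orbit-meets-face-once p zero _ _ _ _ = refl
    short-σ-orbit-meets-face-once {x} p (suc zero) _ _ _ eq = ⊥-elim (face-σ≢ x eq)
    short-σ-orbit-meets-face-once {x} (suc (suc zero)) (suc (suc zero)) period _ _ eq =
      ⊥-elim (face-σ≢ (iter σ 2 x) (trans (cong face period) (sym eq)))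
    short-σ-orbit-meets-face-once zero (suc (suc _)) _ _ (s≤s ()) _
    short-σ-orbit-meets-face-once (suc zero) (suc (suc _)) _ _ (s≤s (s≤s ())) _
    short-σ-orbit-meets-face-once (suc (suc zero)) (suc (suc (suc _))) _ _ (s≤s (s≤s (s≤s ()))) _
    short-σ-orbit-meets-face-once (suc (suc (suc _))) _ _ (s≤s (s≤s (s≤s ()))) _ _

    tl-injective-on-face : ∀ {x y} → tl x ≡ tl y → face x ≡ face y → x ≡ y
    tl-injective-on-face {x} {y} same-tl same-face
      with r , σʳx≡y ← σ-transitive x y same-tl
      with p , p<deg , period ← σ-period x = begin
      x                          ≡⟨ short-σ-orbit-meets-face-once p (r % suc p) period
                                      (≤-trans p<deg (deg≤3 (tl x))) (m%n<n r (suc p)) on-face ⟨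
      iter σ (r % suc p) x       ≡⟨ iter-mod σ period r ⟨
      iter σ r x                 ≡⟨ σʳx≡y ⟩
      y                          ∎
      where
      open ≡-Reasoning
      on-face : face (iter σ (r % suc p) x) ≡ face x
      on-face = trans (cong face (trans (sym (iter-mod σ period r)) σʳx≡y)) (sym same-face)

    period≤faceSize : ∀ {x m} → HasCard (FaceVertex x) m → ∃ λ p → suc p ≤ m × iter φ (suc p) x ≡ x
    period≤faceSize {x} (vertexAt , _ , spec) =
      iter-returns φ φ-injective x index λ {i} {j} eq →
        tl-injective-on-face (trans (sym (vertexAt-index i)) (trans (cong vertexAt eq) (vertexAt-index j)))
                             (trans (face-iter-φ i x) (sym (face-iter-φ j x)))
      where
      index : ℕ → Fin _
      index n = proj₁ (Equivalence.to (spec _) (n , refl))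
      vertexAt-index : ∀ n → vertexAt (index n) ≡ tl (iter φ n x)
      vertexAt-index n = proj₂ (Equivalence.to (spec _) (n , refl))

    face-closes : ∀ {x m} → HasCard (FaceVertex x) m → iter φ m x ≡ x
    face-closes {x} {m} card = closes (period≤faceSize card)
      where
      closes : (∃ λ p → suc p ≤ m × iter φ (suc p) x ≡ x) → iter φ m x ≡ x
      closes (p , p<m , period) =
        subst (λ n → iter φ n x ≡ x) (≤-antisym p<m (faceSize≤period card period)) period

module TilingProperties {g : ℕ} {G : PlaneGraph} (tiling : IsTiling g G) where
  open PlaneGraph G
  open IsTiling tiling
  open PlaneGraphProperties G

  deg≤3 : ∀ v → deg v ≤ 3
  deg≤3 v with FaceVertex? outer v
  ... | yes border = [ (λ deg≡2 → subst (_≤ 3) (sym deg≡2) (n≤1+n 2)) , ≤-reflexive ]′ (deg-border v border)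
  ... | no interior = ≤-reflexive (deg-interior v interior)

  deg≡2⇒Border : ∀ {v} → deg v ≡ 2 → Border v
  deg≡2⇒Border {v} deg≡2 = decidable-stable (FaceVertex? outer v) λ interior →
    contradiction (trans (sym deg≡2) (deg-interior v interior)) λ ()

  closedWalk-of-length-g : ∃ λ v → Walk Adj v v g
  closedWalk-of-length-g =
    tl x₀ , subst (λ y → Walk Adj (tl x₀) (tl y) g)
                  (face-closes two-faces deg≤3 (bounded-faces x₀ λ eq → two-faces outer (sym eq)))
                  (faceWalk x₀ g)
    where
    x₀ = rev outer

module _ {G : PlaneGraph} where
  open PlaneGraph G

  module Antipode {L : ℕ}
    (boundary-closes : iter φ (2 * L) outer ≡ outer)
    {α : Fin nV → Fin nV} (α-boundary : ∀ k → α (tl (iter φ k outer)) ≡ tl (iter φ (k + L) outer)) where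

    α-Border : ∀ {v} → Border v → Border (α v)
    α-Border (k , refl) = k + L , sym (α-boundary k)

    α-involutive : ∀ {v} → Border v → α (α v) ≡ v
    α-involutive (k , refl) = begin
      α (α (tl (iter φ k outer)))          ≡⟨ cong α (α-boundary k) ⟩
      α (tl (iter φ (k + L) outer))        ≡⟨ α-boundary (k + L) ⟩
      tl (iter φ ((k + L) + L) outer)      ≡⟨ cong (λ n → tl (iter φ n outer)) (+-assoc k L L) ⟩
      tl (iter φ (k + (L + L)) outer)      ≡⟨ cong (λ n → tl (iter φ (k + (L + n)) outer)) (+-identityʳ L) ⟨
      tl (iter φ (k + 2 * L) outer)        ≡⟨ cong tl (iter-+ φ k (2 * L) outer) ⟩
      tl (iter φ k (iter φ (2 * L) outer)) ≡⟨ cong (λ x → tl (iter φ k x)) boundary-closes ⟩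
      tl (iter φ k outer)                  ∎
      where open ≡-Reasoning

  module ShortestOddCycle
    {g : ℕ} (tiling : IsTiling g G) (g-odd : Odd g)
    {L : ℕ} (boundary-closes : iter φ (2 * L) outer ≡ outer)
    {α : Fin nV → Fin nV} (α-Adj : ∀ {v w} → Adj v w → Adj (α v) (α w))
    (α-boundary : ∀ k → α (tl (iter φ k outer)) ≡ tl (iter φ (k + L) outer))
    (α-far : ∀ v → Border v → DistGe Adj v (α v) g)
    {h : ℕ} (h-odd : Odd h) {u : ℕ → Fin nV}
    (u-Border : ∀ i → i < 2 * h → Border (u i))
    (u-antipodal : ∀ i → i < h → u (i + h) ≡ α (u i))
    (u-far : ∀ i j → i < j → j < 2 * h → DistGe Adj (u i) (u j) g)
    {k : ℕ} (k-odd : Odd k)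
    (k-minimal : ∀ k′ c′ → IsCycle (TAdj G α h u) k′ c′ → Odd k′ → k ≤ k′)
    where

    open PlaneGraphProperties G
    open TilingProperties tiling
    open Antipode {L = L} boundary-closes {α = α} α-boundary

    T̄ : Fin nV → Fin nV → Set
    T̄ = TAdj G α h u

    Antipodal : Fin nV → Fin nV → Set
    Antipodal x y = (deg x ≡ 2 × y ≡ α x) ⊎ (deg y ≡ 2 × x ≡ α y)

    UEdge : Fin nV → Fin nV → Set
    UEdge x y = ∃ λ i → i < h × ((x ≡ u (2 * i) × y ≡ u (suc (2 * i))) ⊎ (y ≡ u (2 * i) × x ≡ u (suc (2 * i))))

    k≤oddClosedWalk : ∀ {x ℓ} → Walk Adj x x ℓ → Odd ℓ → k ≤ ℓ
    k≤oddClosedWalk w odd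
      with k′ , c′ , (3≤k′ , distinct , steps , closes) , odd′ , k′≤ℓ
         ← oddClosedWalk⇒oddCycle _≟_ Adj Adj-irrefl _ (closedWalk w) odd =
      ≤-trans (k-minimal k′ c′ (3≤k′ , distinct , (λ i i<k′ → inj₁ (steps i i<k′)) , closes) odd′) k′≤ℓ

    closedWalk<k-even : ∀ {x ℓ} → Walk Adj x x ℓ → ℓ < k → parity ℓ ≡ false
    closedWalk<k-even {ℓ = ℓ} w ℓ<k with parity ℓ in pℓ
    ... | true  = contradiction (k≤oddClosedWalk w (parity≡true⇒Odd pℓ)) (<⇒≱ ℓ<k)
    ... | false = refl

    k≤g : k ≤ g
    k≤g = k≤oddClosedWalk (proj₂ closedWalk-of-length-g) g-odd

    k-parity : parity k ≡ true
    k-parity = Odd⇒parity≡true k-odd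

    antipodal-edge : ∀ {x y} → Antipodal x y → Border x × y ≡ α x
    antipodal-edge (inj₁ (deg≡2 , refl)) = deg≡2⇒Border deg≡2 , refl
    antipodal-edge (inj₂ (deg≡2 , refl)) = α-Border (deg≡2⇒Border deg≡2) , sym (α-involutive (deg≡2⇒Border deg≡2))

    u-index-unique : ∀ {p q ℓ} → p < 2 * h → q < 2 * h → Walk Adj (u p) (u q) ℓ → ℓ < g → p ≡ q
    u-index-unique {p} {q} p<2h q<2h w ℓ<g with <-cmp p q
    ... | tri< p<q _ _ = ⊥-elim (u-far p q p<q q<2h _ ℓ<g w)
    ... | tri≈ _ p≡q _ = p≡q
    ... | tri> _ _ q<p = ⊥-elim (u-far q p q<p p<2h _ ℓ<g (reverseWalk Adj-sym w))

    parity-+h : ∀ r → parity (r + h) ≡ not (parity r)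
    parity-+h r = trans (parity-+ r h) (trans (cong (parity r xor_) (Odd⇒parity≡true h-odd))
                                              (trans (xor-comm (parity r) true) (true-xor (parity r))))

    2h≡h+h : 2 * h ≡ h + h
    2h≡h+h = cong (h +_) (+-identityʳ h)

    <h⇒<2h : ∀ {r} → r < h → r < 2 * h
    <h⇒<2h r<h = <-≤-trans r<h (m≤m+n h (h + 0))

    α-u : ∀ {q} → q < 2 * h → ∃ λ q′ → q′ < 2 * h × α (u q) ≡ u q′ × parity q′ ≡ not (parity q)
    α-u {q} q<2h with q <? h
    ... | yes q<h = q + h , subst (q + h <_) (sym 2h≡h+h) (+-monoˡ-< h q<h) , sym (u-antipodal q q<h) , parity-+h q
    ... | no q≮h = r , <h⇒<2h r<h , α-uq≡ur , parity-r
      where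
      r = q ∸ h
      r+h≡q : r + h ≡ q
      r+h≡q = m∸n+n≡m (≮⇒≥ q≮h)
      r<h : r < h
      r<h = +-cancelʳ-< h r h (subst₂ _<_ (sym r+h≡q) 2h≡h+h q<2h)
      α-uq≡ur : α (u q) ≡ u r
      α-uq≡ur = begin
        α (u q)          ≡⟨ cong (λ n → α (u n)) r+h≡q ⟨
        α (u (r + h))    ≡⟨ cong α (u-antipodal r r<h) ⟩
        α (α (u r))      ≡⟨ α-involutive (u-Border r (<h⇒<2h r<h)) ⟩
        u r              ∎
        where open ≡-Reasoning
      parity-r : parity r ≡ not (parity q)
      parity-r = trans (sym (not-involutive (parity r))) (cong not (trans (sym (parity-+h r)) (cong parity r+h≡q)))

    1≤k : 1 ≤ k
    1≤k = subst (1 ≤_) (sym (proj₂ k-odd)) (s≤s z≤n)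

    2i+1<2h : ∀ {i} → i < h → suc (2 * i) < 2 * h
    2i+1<2h {i} i<h = subst (_≤ 2 * h) (*-suc 2 i) (*-monoʳ-≤ 2 i<h)

    UEdge-ends : ∀ {x y} → UEdge x y → ∃₂ λ p p′ → p < 2 * h × p′ < 2 * h × x ≡ u p × y ≡ u p′ × parity p′ ≡ not (parity p)
    UEdge-ends (i , i<h , inj₁ (x≡ , y≡)) =
      2 * i , suc (2 * i) , <-trans (n<1+n _) (2i+1<2h i<h) , 2i+1<2h i<h , x≡ , y≡ , refl
    UEdge-ends (i , i<h , inj₂ (y≡ , x≡)) =
      suc (2 * i) , 2 * i , 2i+1<2h i<h , <-trans (n<1+n _) (2i+1<2h i<h) , x≡ , y≡ , sym (not-involutive _)

    module _ {v : ℕ → Fin nV} (v-walk : ClosedWalk T̄ k v) where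

      module FromUEdge {p₀ p₁ : ℕ} (p₀<2h : p₀ < 2 * h) (p₁<2h : p₁ < 2 * h)
                       (v₀≡up₀ : v 0 ≡ u p₀) (v₁≡up₁ : v 1 ≡ u p₁) (flip₁ : parity p₁ ≡ not (parity p₀)) where

        Reach : ℕ → Set
        Reach j = ∃₂ λ q ℓ → q < 2 * h × Walk Adj (u q) (v j) ℓ × ℓ < j ×
                             parity j ≡ parity ℓ xor parity q xor parity p₀

        start : Reach 1
        start = p₁ , 0 , p₁<2h , subst (λ y → Walk Adj (u p₁) y 0) (sym v₁≡up₁) here , z<s ,
                sym (trans (cong (_xor parity p₀) flip₁) (xor-inverseˡ (parity p₀)))

        along-Adj : ∀ {j} → Reach j → Adj (v j) (v (suc j)) → Reach (suc j)
        along-Adj (q , ℓ , q<2h , w , ℓ<j , inv) adj =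
          q , suc ℓ , q<2h , w ∷ʳ adj , s≤s ℓ<j , trans (cong not inv) (not-distribˡ-xor (parity ℓ) _)

        along-Antipodal : ∀ {j} → Reach j → Antipodal (v j) (v (suc j)) → Reach (suc j)
        along-Antipodal (q , ℓ , q<2h , w , ℓ<j , inv) a =
          let q′ , q′<2h , αuq≡uq′ , flip = α-u q<2h in
          q′ , ℓ , q′<2h ,
          subst₂ (λ x y → Walk Adj x y ℓ) αuq≡uq′ (sym (proj₂ (antipodal-edge a))) (mapWalk α α-Adj w) ,
          m<n⇒m<1+n ℓ<j ,
          trans (cong not inv) (trans (not-distribʳ-xor (parity ℓ) _) (cong (parity ℓ xor_) (flip-xor _ flip)))

        along-UEdge : ∀ {j} → j < k → Reach j → UEdge (v j) (v (suc j)) → Reach (suc j)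
        along-UEdge {j} j<k (q , ℓ , q<2h , w , ℓ<j , inv) e =
          let p , p′ , p<2h , p′<2h , vj≡up , vj+1≡up′ , flip = UEdge-ends e
              w′ = subst (λ y → Walk Adj (u q) y ℓ) vj≡up w
              q≡p = u-index-unique q<2h p<2h w′ (<-trans ℓ<j (<-≤-trans j<k k≤g))
              loop = subst (λ r → Walk Adj (u q) (u r) ℓ) (sym q≡p) w′
          in
          p′ , 0 , p′<2h , subst (λ y → Walk Adj (u p′) y 0) (sym vj+1≡up′) here , z<s ,
          (begin
            not (parity j)                                 ≡⟨ cong not inv ⟩
            not (parity ℓ xor parity q xor parity p₀)      ≡⟨ cong₂ (λ a b → not (a xor parity b xor parity p₀))
                                                                    (closedWalk<k-even loop (<-trans ℓ<j j<k)) q≡p ⟩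
            not (parity p xor parity p₀)                   ≡⟨ flip-xor _ flip ⟩
            parity p′ xor parity p₀                        ∎)
          where open ≡-Reasoning

        advance : ∀ j → j < k → Reach j → Reach (suc j)
        advance j j<k reach = [ along-Adj reach , [ along-Antipodal reach , along-UEdge j<k reach ]′ ]′ (proj₁ v-walk j j<k)

        final : Reach k → ⊥
        final (q , ℓ , q<2h , w , ℓ<k , inv) =
          let loop = subst (λ y → Walk Adj (u q) y ℓ) (trans (proj₂ v-walk) v₀≡up₀) w
              q≡p₀ = u-index-unique q<2h p₀<2h loop (<-≤-trans ℓ<k k≤g)
              loop′ = subst (λ r → Walk Adj (u q) (u r) ℓ) (sym q≡p₀) loop
          in
          contradiction (begin
            true                                        ≡⟨ k-parity ⟨
            parity k                                    ≡⟨ inv ⟩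
            parity ℓ xor parity q xor parity p₀         ≡⟨ cong₂ (λ a b → a xor parity b xor parity p₀)
                                                                  (closedWalk<k-even loop′ ℓ<k) q≡p₀ ⟩
            parity p₀ xor parity p₀                     ≡⟨ xor-same (parity p₀) ⟩
            false                                       ∎) λ ()
          where open ≡-Reasoning

        impossible : ⊥
        impossible = final (invariant-from-1 start advance 1≤k)

      no-initial-UEdge : ¬ UEdge (v 0) (v 1)
      no-initial-UEdge e =
        let p₀ , p₁ , p₀<2h , p₁<2h , v₀≡up₀ , v₁≡up₁ , flip₁ = UEdge-ends e
        in FromUEdge.impossible p₀<2h p₁<2h v₀≡up₀ v₁≡up₁ flip₁

      module FromAntipodal (no-UEdge : ∀ j → j < k → ¬ UEdge (v j) (v (suc j)))
                           (v₀-Border : Border (v 0)) (v₁≡αv₀ : v 1 ≡ α (v 0)) where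

        source : Bool → Fin nV
        source b = if b then α (v 0) else v 0

        α-source : ∀ b → α (source b) ≡ source (not b)
        α-source true  = α-involutive v₀-Border
        α-source false = refl

        Reach : ℕ → Set
        Reach j = ∃₂ λ b ℓ → Walk Adj (source b) (v j) ℓ × ℓ < j × parity j ≡ parity ℓ xor b

        start : Reach 1
        start = true , 0 , subst (λ y → Walk Adj (α (v 0)) y 0) (sym v₁≡αv₀) here , z<s , refl

        along : ∀ {j} → j < k → Reach j → T̄ (v j) (v (suc j)) → Reach (suc j)
        along j<k (b , ℓ , w , ℓ<j , inv) (inj₁ adj) =
          b , suc ℓ , w ∷ʳ adj , s≤s ℓ<j , trans (cong not inv) (not-distribˡ-xor (parity ℓ) b)
        along j<k (b , ℓ , w , ℓ<j , inv) (inj₂ (inj₁ a)) =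
          not b , ℓ ,
          subst₂ (λ x y → Walk Adj x y ℓ) (α-source b) (sym (proj₂ (antipodal-edge a))) (mapWalk α α-Adj w) ,
          m<n⇒m<1+n ℓ<j , trans (cong not inv) (not-distribʳ-xor (parity ℓ) b)
        along j<k _ (inj₂ (inj₂ e)) = ⊥-elim (no-UEdge _ j<k e)

        final : Reach k → ⊥
        final (false , ℓ , w , ℓ<k , inv) =
          contradiction (trans (sym k-parity) (trans inv (trans (xor-identityʳ _) (closedWalk<k-even loop ℓ<k)))) λ ()
          where
          loop : Walk Adj (v 0) (v 0) ℓ
          loop = subst (λ y → Walk Adj (v 0) y ℓ) (proj₂ v-walk) w
        final (true , ℓ , w , ℓ<k , inv) =
          α-far (v 0) v₀-Border ℓ (<-≤-trans ℓ<k k≤g) (reverseWalk Adj-sym back)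
          where
          back : Walk Adj (α (v 0)) (v 0) ℓ
          back = subst (λ y → Walk Adj (α (v 0)) y ℓ) (proj₂ v-walk) w

        advance : ∀ j → j < k → Reach j → Reach (suc j)
        advance j j<k reach = along j<k reach (proj₁ v-walk j j<k)

        impossible : ⊥
        impossible = final (invariant-from-1 start advance 1≤k)

      no-initial-Antipodal : (∀ j → j < k → ¬ UEdge (v j) (v (suc j))) → ¬ Antipodal (v 0) (v 1)
      no-initial-Antipodal no-UEdge a = FromAntipodal.impossible no-UEdge (proj₁ (antipodal-edge a)) (proj₂ (antipodal-edge a))

    module _ {c : ℕ → Fin nV} (cycle : IsCycle T̄ k c) where

      private instance
        k-nonZero : NonZero k
        k-nonZero = >-nonZero (<-≤-trans z<s (proj₁ cycle))

      c-walk : ClosedWalk T̄ k c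
      c-walk = proj₁ (proj₂ (proj₂ cycle)) , proj₂ (proj₂ (proj₂ cycle))

      rotated : ∀ i → ClosedWalk T̄ k (rotate k c i)
      rotated = rotate-closedWalk {R = T̄} {f = c} c-walk

      rotated-start : ∀ {i} → i < k → rotate k c i 0 ≡ c i × rotate k c i 1 ≡ c (suc i)
      rotated-start = rotate-start {f = c} (proj₂ c-walk)

      no-UEdge : ∀ i → i < k → ¬ UEdge (c i) (c (suc i))
      no-UEdge i i<k e =
        no-initial-UEdge {v = rotate k c i} (rotated i)
          (subst₂ UEdge (sym (proj₁ (rotated-start i<k))) (sym (proj₂ (rotated-start i<k))) e)

      no-Antipodal : ∀ i → i < k → ¬ Antipodal (c i) (c (suc i))
      no-Antipodal i i<k a =
        no-initial-Antipodal {v = rotate k c i} (rotated i)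
          (λ j _ → rotate-steps {f = c} (proj₂ c-walk) {S = λ x y → ¬ UEdge x y} no-UEdge i j)
          (subst₂ Antipodal (sym (proj₁ (rotated-start i<k))) (sym (proj₂ (rotated-start i<k))) a)

      edges-in-G : ∀ i → i < k → Adj (c i) (c (suc i))
      edges-in-G i i<k with proj₁ c-walk i i<k
      ... | inj₁ adj = adj
      ... | inj₂ (inj₁ a) = ⊥-elim (no-Antipodal i i<k a)
      ... | inj₂ (inj₂ e) = ⊥-elim (no-UEdge i i<k e)

lemma4p8 : (g : ℕ) → (G : PlaneGraph) → IsTiling g G →
    -- (i)
    7 ≤ g → Odd g →
    -- (ii)
    (L : ℕ) → BoundaryEvenCycle G L →
    -- (iii)
    (α : Fin (PlaneGraph.nV G) → Fin (PlaneGraph.nV G)) → IsAutomorphism G α →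
    (∀ k → α (PlaneGraph.tl G (iter (PlaneGraph.φ G) k (PlaneGraph.outer G)))
             ≡ PlaneGraph.tl G (iter (PlaneGraph.φ G) (k + L) (PlaneGraph.outer G))) →
    -- (iv)
    (∀ x → PlaneGraph.Border G x → DistGe (PlaneGraph.Adj G) x (α x) g) →
    -- (v)
    (h : ℕ) → Odd h → suc g ≤ 2 * h →
    (u : ℕ → Fin (PlaneGraph.nV G)) →
    (∀ i → i < 2 * h → PlaneGraph.Border G (u i) × PlaneGraph.deg G (u i) ≡ 2) →
    (∀ i → i < h → u (i + h) ≡ α (u i)) →
    (∀ i j → i < j → j < 2 * h → DistGe (PlaneGraph.Adj G) (u i) (u j) g) →
    -- conclusion: every shortest odd cycle of T̄ lies in G
    (k : ℕ) → (c : ℕ → Fin (PlaneGraph.nV G)) →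
    IsCycle (TAdj G α h u) k c → Odd k →
    (∀ k' c' → IsCycle (TAdj G α h u) k' c' → Odd k' → k ≤ k') →
    ∀ i → i < k → PlaneGraph.Adj G (c i) (c (suc i))
lemma4p8 g G tiling _ g-odd L (_ , boundary-closes , _) α (_ , α-preserves-Adj) α-boundary α-far
         h h-odd _ u u-spec u-antipodal u-far k c cycle k-odd k-minimal =
  ShortestOddCycle.edges-in-G tiling g-odd boundary-closes (Equivalence.to (α-preserves-Adj _ _)) α-boundary α-far
    h-odd (λ i i<2h → proj₁ (u-spec i i<2h)) u-antipodal u-far k-odd k-minimal cycle
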